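{- For all integers $k\ge 2$ and $l\ge \frac{2k^{2}}{\ln k}$, $$\left\lceil \frac{2k+l}{k}\right\rceil \binom{k+l}{k} > \binom{2k+l}{k}.$$ -}

module Defs where

open import Data.Nat using (ℕ; zero; suc; _+_; _*_; _∸_; _^_; _!; NonZero)
open import Data.Nat.DivMod using (_/_)
open import Data.Nat.Properties using (_!≢0)
open import Data.Integer using (+_)
import Data.Rational as ℚ
open ℚ using (ℚ)

-- Ceiling of a natural-number quotient: ⌈ a / b ⌉ = (a + b - 1) / b  for b ≠ 0
-- (junk value 0 for b = 0; only used with b = k ≥ 2).
⌈_/_⌉ : ℕ → ℕ → ℕ
⌈ a / zero ⌉ = zero
⌈ a / suc b ⌉ = (a + b) / suc b

expTerm : ℕ → ℕ → ℚ
expTerm x n = (+ (x ^ n)) ℚ./ (n !)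
  where instance _ = n !≢0

expPartial : ℕ → ℕ → ℚ
expPartial x zero    = expTerm x zero
expPartial x (suc N) = expPartial x N ℚ.+ expTerm x (suc N)

-- exp(x) ≤ y  for naturals x, y, expressed exactly: exp(x) is the supremum of
-- the (increasing) partial sums of its series, so exp(x) ≤ y iff every partial
-- sum is ≤ y.
ExpLe : ℕ → ℕ → Set
ExpLe x y = ∀ N → expPartial x N ℚ.≤ (+ y) ℚ./ 1

-- For k ≥ 2 (so ln k > 0):  l ≥ 2k²/ln k  ⟺  l·ln k ≥ 2k²  ⟺  exp(2k²) ≤ k^l.
LBound : ℕ → ℕ → Set
LBound k l = ExpLe (2 * (k * k)) (k ^ l)

{-# OPTIONS --safe #-}
-- Put A = (k + l)^k and B = l^k, so that r = A/B = (1 + k/l)^k. Then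
-- C(2k+l,k)/C(k+l,k) = ∏ᵢ (k+l+i)/(l+i) ≤ r, Bernoulli gives r ≥ 1 + k²/l, and
-- r² ≤ exp(2k²/l) ≤ k by the hypothesis on l. If the inequality failed, then
-- l/k < ⌈(2k+l)/k⌉ ≤ C(2k+l,k)/C(k+l,k) ≤ r, hence r² ≥ (l/k)(1 + k²/l) > k.
-- For l = 0 the hypothesis exp(2k²) ≤ 1 is false.
module Submission where

open import Defs
open import Data.Nat using (ℕ; _+_; _*_; _≤_; _>_)
open import Data.Nat.Combinatorics using (_C_)
open import Data.Nat.Base using (zero; suc; _∸_; _^_; _!; _<_; NonZero; >-nonZero; z≤n; s≤s; z<s; +-*-rawSemiring)
open import Data.Nat.Properties
open import Data.Nat.Combinatorics using (nCk+nC[k+1]≡[n+1]C[k+1]; nC1≡n)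
open import Data.Nat.Combinatorics.Specification using (k>n⇒nCk≡0)
open import Data.Nat.DivMod using (_/_; _%_; m≡m%n+[m/n]*n; m%n<n)
open import Data.Nat.Tactic.RingSolver using (solve; solve-∀)
open import Data.Fin.Base using (Fin; toℕ)
open import Data.Fin.Properties using (toℕ-inject₁; toℕ-fromℕ)
open import Data.List.Base using (_∷_; [])
import Data.Integer.Base as ℤ
import Data.Integer.Properties as ℤ
import Data.Rational as ℚ
import Data.Rational.Properties as ℚ
import Data.Rational.Unnormalised as ℚᵘ
open ℚᵘ using (ℚᵘ; mkℚᵘ; *≤*; *≡*)
import Data.Rational.Unnormalised.Properties as ℚᵘ
open import Function.Base using (_∘_)
open import Relation.Binary.PropositionalEquality
open import Relation.Nullary using (yes; no; contradiction)
import Algebra.Definitions.RawSemiring as RawSemiringDefinitions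
import Algebra.Properties.CommutativeSemiring.Binomial as Binomial
open import Algebra.Properties.CommutativeSemigroup *-commutativeSemigroup
  using (interchange; xy∙z≈xz∙y)
open import Algebra.Properties.Monoid.Sum +-0-monoid using (sum; sum-init-last; sum-cong-≗)

^-distrib-* : ∀ m n k → (m * n) ^ k ≡ m ^ k * n ^ k
^-distrib-* m n zero    = refl
^-distrib-* m n (suc k) = begin
  m * n * (m * n) ^ k      ≡⟨ cong (m * n *_) (^-distrib-* m n k) ⟩
  m * n * (m ^ k * n ^ k)  ≡⟨ interchange m n (m ^ k) (n ^ k) ⟩
  m * m ^ k * (n * n ^ k)  ∎
  where open ≡-Reasoning

^-cancelˡ-≤ : ∀ n .{{_ : NonZero n}} {m o} → m ^ n ≤ o ^ n → m ≤ o
^-cancelˡ-≤ n mⁿ≤oⁿ = ≮⇒≥ λ o<m → <⇒≱ (^-monoˡ-< n o<m) mⁿ≤oⁿ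

m≤n*⌈m/n⌉ : ∀ m n → m ≤ suc n * ⌈ m / suc n ⌉
m≤n*⌈m/n⌉ m n = +-cancelʳ-≤ n m _ (begin
  m + n                                 ≡⟨ m≡m%n+[m/n]*n (m + n) (suc n) ⟩
  (m + n) % suc n + q * suc n           ≤⟨ +-monoˡ-≤ (q * suc n) (≤-pred (m%n<n (m + n) (suc n))) ⟩
  n + q * suc n                         ≡⟨ trans (+-comm n _) (cong (_+ n) (*-comm q (suc n))) ⟩
  suc n * q + n                         ∎)
  where
  open ≤-Reasoning
  q = (m + n) / suc n

m*o≤n⇒n*p≤o*q⇒m*p≤q : ∀ {m n o p q} → 0 < o → m * o ≤ n → n * p ≤ o * q → m * p ≤ q
m*o≤n⇒n*p≤o*q⇒m*p≤q {m} {n} {o} {p} {q} 0<o mo≤n np≤oq = *-cancelˡ-≤ o {{>-nonZero 0<o}} (begin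
  o * (m * p)  ≡⟨ solve (m ∷ o ∷ p ∷ []) ⟩
  m * o * p    ≤⟨ *-monoˡ-≤ p mo≤n ⟩
  n * p        ≤⟨ np≤oq ⟩
  o * q        ∎)
  where open ≤-Reasoning

l^m*[l+m*d]≤l*[l+d]^m : ∀ l d m → l ^ m * (l + m * d) ≤ l * (l + d) ^ m
l^m*[l+m*d]≤l*[l+d]^m l d zero    = ≤-reflexive (solve (l ∷ d ∷ []))
l^m*[l+m*d]≤l*[l+d]^m l d (suc m) = begin
  l * p * (l + (d + m * d))        ≡⟨ expand l p d (m * d) ⟩
  l * (p * (l + m * d)) + l * p * d ≤⟨ +-mono-≤ (*-monoʳ-≤ l (l^m*[l+m*d]≤l*[l+d]^m l d m))
                                                 (*-monoˡ-≤ d (*-monoʳ-≤ l (^-monoˡ-≤ m (m≤m+n l d)))) ⟩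
  l * (l * q) + l * q * d          ≡⟨ collect l q d ⟩
  l * ((l + d) * q)                ∎
  where
  open ≤-Reasoning
  p = l ^ m
  q = (l + d) ^ m
  expand : ∀ l p d e → l * p * (l + (d + e)) ≡ l * (p * (l + e)) + l * p * d
  expand = solve-∀
  collect : ∀ l q d → l * (l * q) + l * q * d ≡ l * ((l + d) * q)
  collect = solve-∀

[k+1]*[n+1]C[k+1]≡[n+1]*nCk : ∀ n k → suc k * (suc n C suc k) ≡ suc n * (n C k)
[k+1]*[n+1]C[k+1]≡[n+1]*nCk zero    zero    = refl
[k+1]*[n+1]C[k+1]≡[n+1]*nCk zero    (suc k) = begin
  suc (suc k) * (1 C suc (suc k)) ≡⟨ cong (suc (suc k) *_) (k>n⇒nCk≡0 {1} {suc (suc k)} (s≤s (s≤s z≤n))) ⟩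
  suc (suc k) * 0                 ≡⟨ *-zeroʳ (suc (suc k)) ⟩
  0                               ∎
  where open ≡-Reasoning
[k+1]*[n+1]C[k+1]≡[n+1]*nCk (suc n) zero    = begin
  suc (suc n) C 1 + 0 ≡⟨ +-identityʳ _ ⟩
  suc (suc n) C 1     ≡⟨ nC1≡n (suc (suc n)) ⟩
  suc (suc n)         ≡⟨ sym (*-identityʳ (suc (suc n))) ⟩
  suc (suc n) * 1     ∎
  where open ≡-Reasoning
[k+1]*[n+1]C[k+1]≡[n+1]*nCk (suc n) (suc k) = begin
  suc (suc k) * (suc (suc n) C suc (suc k))
    ≡⟨ cong (suc (suc k) *_) (sym (nCk+nC[k+1]≡[n+1]C[k+1] (suc n) (suc k))) ⟩
  suc (suc k) * (c + suc n C suc (suc k))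
    ≡⟨ *-distribˡ-+ (suc (suc k)) c _ ⟩
  c + suc k * c + suc (suc k) * (suc n C suc (suc k))
    ≡⟨ cong₂ (λ u v → c + u + v) ([k+1]*[n+1]C[k+1]≡[n+1]*nCk n k) ([k+1]*[n+1]C[k+1]≡[n+1]*nCk n (suc k)) ⟩
  c + suc n * (n C k) + suc n * (n C suc k)
    ≡⟨ +-assoc c _ _ ⟩
  c + (suc n * (n C k) + suc n * (n C suc k))
    ≡⟨ cong (c +_) (sym (*-distribˡ-+ (suc n) (n C k) (n C suc k))) ⟩
  c + suc n * (n C k + n C suc k)
    ≡⟨ cong (λ d → c + suc n * d) (nCk+nC[k+1]≡[n+1]C[k+1] n k) ⟩
  suc (suc n) * c
    ∎
  where
  open ≡-Reasoning
  c = suc n C suc k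

nCk*k!≤n^k : ∀ n k → (n C k) * k ! ≤ n ^ k
nCk*k!≤n^k n       zero    = ≤-refl
nCk*k!≤n^k zero    (suc k) = z≤n
nCk*k!≤n^k (suc n) (suc k) = begin
  (suc n C suc k) * (suc k * k !)  ≡⟨ sym (*-assoc (suc n C suc k) (suc k) (k !)) ⟩
  (suc n C suc k) * suc k * k !    ≡⟨ cong (_* k !) (*-comm (suc n C suc k) (suc k)) ⟩
  suc k * (suc n C suc k) * k !  ≡⟨ cong (_* k !) ([k+1]*[n+1]C[k+1]≡[n+1]*nCk n k) ⟩
  suc n * (n C k) * k !          ≡⟨ *-assoc (suc n) (n C k) (k !) ⟩
  suc n * ((n C k) * k !)          ≤⟨ *-monoʳ-≤ (suc n) (nCk*k!≤n^k n k) ⟩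
  suc n * n ^ k                  ≤⟨ *-monoʳ-≤ (suc n) (^-monoˡ-≤ k (n≤1+n n)) ⟩
  suc n * suc n ^ k              ∎
  where open ≤-Reasoning

nCk>0 : ∀ {n k} → k ≤ n → 0 < n C k
nCk>0 {n}     {zero}  _         = z<s
nCk>0 {suc n} {suc k} (s≤s k≤n) = begin-strict
  0                    <⟨ nCk>0 k≤n ⟩
  n C k                ≤⟨ m≤m+n (n C k) (n C suc k) ⟩
  n C k + n C suc k    ≡⟨ nCk+nC[k+1]≡[n+1]C[k+1] n k ⟩
  suc n C suc k        ∎
  where open ≤-Reasoning

[k+a]Ck*b^k≤[k+b]Ck*a^k : ∀ {a b} → b ≤ a → ∀ k → ((k + a) C k) * b ^ k ≤ ((k + b) C k) * a ^ k
[k+a]Ck*b^k≤[k+b]Ck*a^k b≤a zero    = ≤-refl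
[k+a]Ck*b^k≤[k+b]Ck*a^k {a} {b} b≤a (suc k) = *-cancelˡ-≤ (suc k) (begin
  suc k * ((suc (k + a) C suc k) * (b * b ^ k))  ≡⟨ *-assoc (suc k) (suc (k + a) C suc k) (b * b ^ k) ⟨
  suc k * (suc (k + a) C suc k) * (b * b ^ k)  ≡⟨ cong (_* (b * b ^ k)) ([k+1]*[n+1]C[k+1]≡[n+1]*nCk (k + a) k) ⟩
  suc (k + a) * ((k + a) C k) * (b * b ^ k)    ≡⟨ interchange (suc (k + a)) ((k + a) C k) b (b ^ k) ⟩
  suc (k + a) * b * (((k + a) C k) * b ^ k)      ≤⟨ *-mono-≤ cross ([k+a]Ck*b^k≤[k+b]Ck*a^k b≤a k) ⟩
  suc (k + b) * a * (((k + b) C k) * a ^ k)      ≡⟨ interchange (suc (k + b)) a ((k + b) C k) (a ^ k) ⟩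
  suc (k + b) * ((k + b) C k) * (a * a ^ k)    ≡⟨ cong (_* (a * a ^ k)) ([k+1]*[n+1]C[k+1]≡[n+1]*nCk (k + b) k) ⟨
  suc k * (suc (k + b) C suc k) * (a * a ^ k)  ≡⟨ *-assoc (suc k) (suc (k + b) C suc k) (a * a ^ k) ⟩
  suc k * ((suc (k + b) C suc k) * (a * a ^ k))  ∎)
  where
  open ≤-Reasoning
  cross : suc (k + a) * b ≤ suc (k + b) * a
  cross = begin
    suc (k + a) * b    ≡⟨ solve (k ∷ a ∷ b ∷ []) ⟩
    suc k * b + a * b  ≤⟨ +-monoˡ-≤ (a * b) (*-monoʳ-≤ (suc k) b≤a) ⟩
    suc k * a + a * b  ≡⟨ solve (k ∷ a ∷ b ∷ []) ⟩
    suc (k + b) * a    ∎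

sumUpTo : (ℕ → ℕ) → ℕ → ℕ
sumUpTo f zero    = f zero
sumUpTo f (suc n) = sumUpTo f n + f (suc n)

binomialTerm : ℕ → ℕ → ℕ → ℕ → ℕ
binomialTerm n a b j = (n C j) * (a ^ j * b ^ (n ∸ j))

private
  module Semiring = RawSemiringDefinitions +-*-rawSemiring

  Semiring-^≡^ : ∀ x n → x Semiring.^ n ≡ x ^ n
  Semiring-^≡^ x zero    = refl
  Semiring-^≡^ x (suc n) = cong (x *_) (Semiring-^≡^ x n)

  Semiring-×≡* : ∀ n x → n Semiring.× x ≡ n * x
  Semiring-×≡* zero    x = refl
  Semiring-×≡* (suc n) x = cong (x +_) (Semiring-×≡* n x)

sum∘toℕ≡sumUpTo : ∀ n f → sum {suc n} (f ∘ toℕ) ≡ sumUpTo f n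
sum∘toℕ≡sumUpTo zero    f = +-identityʳ (f 0)
sum∘toℕ≡sumUpTo (suc n) f = trans (sum-init-last (f ∘ toℕ)) (cong₂ _+_
  (trans (sum-cong-≗ {suc n} (cong f ∘ toℕ-inject₁)) (sum∘toℕ≡sumUpTo n f))
  (cong f (toℕ-fromℕ (suc n))))

binomial-theorem : ∀ n a b → (a + b) ^ n ≡ sumUpTo (binomialTerm n a b) n
binomial-theorem n a b = begin
  (a + b) ^ n                                              ≡⟨ Semiring-^≡^ (a + b) n ⟨
  (a + b) Semiring.^ n                                     ≡⟨ Binomial.theorem +-*-commutativeSemiring n a b ⟩
  Binomial.binomialExpansion +-*-commutativeSemiring a b n ≡⟨ sum-cong-≗ {suc n} term≡binomialTerm ⟩
  sum {suc n} (binomialTerm n a b ∘ toℕ)                   ≡⟨ sum∘toℕ≡sumUpTo n (binomialTerm n a b) ⟩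
  sumUpTo (binomialTerm n a b) n                           ∎
  where
  open ≡-Reasoning
  term≡binomialTerm : ∀ (j : Fin (suc n)) →
    (n C toℕ j) Semiring.× (a Semiring.^ toℕ j * b Semiring.^ (n ∸ toℕ j)) ≡ binomialTerm n a b (toℕ j)
  term≡binomialTerm j = trans (Semiring-×≡* (n C toℕ j) _)
    (cong ((n C toℕ j) *_) (cong₂ _*_ (Semiring-^≡^ a (toℕ j)) (Semiring-^≡^ b (n ∸ toℕ j))))

ℕ→ℚᵘ : ℕ → ℚᵘ
ℕ→ℚᵘ n = ℤ.+ n ℚᵘ./ 1

ℕ→ℚᵘ-homo-+ : ∀ m n → ℕ→ℚᵘ (m + n) ℚᵘ.≃ ℕ→ℚᵘ m ℚᵘ.+ ℕ→ℚᵘ n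
ℕ→ℚᵘ-homo-+ m n = *≡* (cong (ℤ._* ℤ.+ 1) (begin
  ℤ.+ (m + n)                         ≡⟨ ℤ.pos-+ m n ⟩
  ℤ.+ m ℤ.+ ℤ.+ n                     ≡⟨ cong₂ ℤ._+_ (ℤ.*-identityʳ (ℤ.+ m)) (ℤ.*-identityʳ (ℤ.+ n)) ⟨
  ℤ.+ m ℤ.* ℤ.+ 1 ℤ.+ ℤ.+ n ℤ.* ℤ.+ 1 ∎))
  where open ≡-Reasoning

ℕ→ℚᵘ-homo-* : ∀ m n → ℕ→ℚᵘ (m * n) ℚᵘ.≃ ℕ→ℚᵘ m ℚᵘ.* ℕ→ℚᵘ n
ℕ→ℚᵘ-homo-* m n = *≡* (cong (ℤ._* ℤ.+ 1) (ℤ.pos-* m n))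

ℕ→ℚᵘ-cancel-≤ : ∀ {m n} → ℕ→ℚᵘ m ℚᵘ.≤ ℕ→ℚᵘ n → m ≤ n
ℕ→ℚᵘ-cancel-≤ {m} {n} (*≤* m≤n) =
  ℤ.drop‿+≤+ (subst₂ ℤ._≤_ (ℤ.*-identityʳ (ℤ.+ m)) (ℤ.*-identityʳ (ℤ.+ n)) m≤n)

toℚᵘ-/ : ∀ i n .{{_ : NonZero n}} → ℚ.toℚᵘ (i ℚ./ n) ℚᵘ.≃ i ℚᵘ./ n
toℚᵘ-/ i (suc n) = ℚ.toℚᵘ-fromℚᵘ (mkℚᵘ i n)

m*d≤n⇒m≤n/d : ∀ {m n} d .{{_ : NonZero d}} → m * d ≤ n → ℕ→ℚᵘ m ℚᵘ.≤ ℤ.+ n ℚᵘ./ d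
m*d≤n⇒m≤n/d {m} {n} (suc d) md≤n =
  *≤* (subst₂ ℤ._≤_ (ℤ.pos-* m (suc d)) (sym (ℤ.*-identityʳ (ℤ.+ n))) (ℤ.+≤+ md≤n))

ℕ→ℚᵘ-*-/ : ∀ m n d .{{_ : NonZero d}} → ℕ→ℚᵘ m ℚᵘ.* (ℤ.+ n ℚᵘ./ d) ℚᵘ.≃ ℤ.+ (m * n) ℚᵘ./ d
ℕ→ℚᵘ-*-/ m n (suc d) = *≡* (cong₂ ℤ._*_ (sym (ℤ.pos-* m n)) (cong ℤ.+_ (sym (*-identityˡ (suc d)))))

m*j!≤B*x^j⇒m≤B*expTerm : ∀ m B x j → m * j ! ≤ B * x ^ j →
                          ℕ→ℚᵘ m ℚᵘ.≤ ℕ→ℚᵘ B ℚᵘ.* ℚ.toℚᵘ (expTerm x j)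
m*j!≤B*x^j⇒m≤B*expTerm m B x j mj!≤Bxʲ = begin
  ℕ→ℚᵘ m                                     ≤⟨ m*d≤n⇒m≤n/d (j !) mj!≤Bxʲ ⟩
  ℤ.+ (B * x ^ j) ℚᵘ./ j !                   ≃⟨ ℕ→ℚᵘ-*-/ B (x ^ j) (j !) ⟨
  ℕ→ℚᵘ B ℚᵘ.* (ℤ.+ (x ^ j) ℚᵘ./ j !)          ≃⟨ ℚᵘ.*-congˡ {ℕ→ℚᵘ B} (toℚᵘ-/ (ℤ.+ (x ^ j)) (j !)) ⟨
  ℕ→ℚᵘ B ℚᵘ.* ℚ.toℚᵘ (expTerm x j)           ∎
  where
  open ℚᵘ.≤-Reasoning
  instance _ = j !≢0

sumUpTo≤B*expPartial : ∀ x B (T : ℕ → ℕ) → (∀ j → T j * j ! ≤ B * x ^ j) →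
                       ∀ n → ℕ→ℚᵘ (sumUpTo T n) ℚᵘ.≤ ℕ→ℚᵘ B ℚᵘ.* ℚ.toℚᵘ (expPartial x n)
sumUpTo≤B*expPartial x B T T≤ zero    = m*j!≤B*x^j⇒m≤B*expTerm (T 0) B x 0 (T≤ 0)
sumUpTo≤B*expPartial x B T T≤ (suc n) = begin
  ℕ→ℚᵘ (sumUpTo T n + T (suc n))                          ≃⟨ ℕ→ℚᵘ-homo-+ (sumUpTo T n) (T (suc n)) ⟩
  ℕ→ℚᵘ (sumUpTo T n) ℚᵘ.+ ℕ→ℚᵘ (T (suc n))                ≤⟨ ℚᵘ.+-mono-≤ (sumUpTo≤B*expPartial x B T T≤ n)
                                                                (m*j!≤B*x^j⇒m≤B*expTerm (T (suc n)) B x (suc n) (T≤ (suc n))) ⟩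
  ℕ→ℚᵘ B ℚᵘ.* ℚ.toℚᵘ E ℚᵘ.+ ℕ→ℚᵘ B ℚᵘ.* ℚ.toℚᵘ e          ≃⟨ ℚᵘ.*-distribˡ-+ (ℕ→ℚᵘ B) (ℚ.toℚᵘ E) (ℚ.toℚᵘ e) ⟨
  ℕ→ℚᵘ B ℚᵘ.* (ℚ.toℚᵘ E ℚᵘ.+ ℚ.toℚᵘ e)                    ≃⟨ ℚᵘ.*-congˡ {ℕ→ℚᵘ B} (ℚ.toℚᵘ-homo-+ E e) ⟨
  ℕ→ℚᵘ B ℚᵘ.* ℚ.toℚᵘ (E ℚ.+ e)                            ∎
  where
  open ℚᵘ.≤-Reasoning
  E = expPartial x n
  e = expTerm x (suc n)

binomialTerm*j!≤b^n*x^j : ∀ {x n a b} → x * b ≡ n * a → ∀ j → binomialTerm n a b j * j ! ≤ b ^ n * x ^ j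
binomialTerm*j!≤b^n*x^j {x} {n} {a} {b} xb≡na j with j ≤? n
... | no  j≰n rewrite k>n⇒nCk≡0 (≰⇒> j≰n) = z≤n
... | yes j≤n = begin
  (n C j) * (a ^ j * b ^ (n ∸ j)) * j !  ≡⟨ xy∙z≈xz∙y (n C j) (a ^ j * b ^ (n ∸ j)) (j !) ⟩
  (n C j) * j ! * (a ^ j * b ^ (n ∸ j))  ≤⟨ *-monoˡ-≤ (a ^ j * b ^ (n ∸ j)) (nCk*k!≤n^k n j) ⟩
  n ^ j * (a ^ j * b ^ (n ∸ j))          ≡⟨ *-assoc (n ^ j) (a ^ j) (b ^ (n ∸ j)) ⟨
  n ^ j * a ^ j * b ^ (n ∸ j)            ≡⟨ cong (_* b ^ (n ∸ j)) (^-distrib-* n a j) ⟨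
  (n * a) ^ j * b ^ (n ∸ j)              ≡⟨ cong (λ c → c ^ j * b ^ (n ∸ j)) xb≡na ⟨
  (x * b) ^ j * b ^ (n ∸ j)              ≡⟨ cong (_* b ^ (n ∸ j)) (^-distrib-* x b j) ⟩
  x ^ j * b ^ j * b ^ (n ∸ j)            ≡⟨ *-assoc (x ^ j) (b ^ j) (b ^ (n ∸ j)) ⟩
  x ^ j * (b ^ j * b ^ (n ∸ j))          ≡⟨ cong (x ^ j *_) (^-distribˡ-+-* b j (n ∸ j)) ⟨
  x ^ j * b ^ (j + (n ∸ j))              ≡⟨ cong (λ i → x ^ j * b ^ i) (m+[n∸m]≡n j≤n) ⟩
  x ^ j * b ^ n                          ≡⟨ *-comm (x ^ j) (b ^ n) ⟩
  b ^ n * x ^ j                          ∎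
  where open ≤-Reasoning

-- (1 + a/b)ⁿ ≤ exp(na/b), termwise: C(n,j)(a/b)ʲ ≤ (na/b)ʲ/j!.
[a+b]^n≤b^n*y : ∀ x y n a b → ExpLe x y → x * b ≡ n * a → (a + b) ^ n ≤ b ^ n * y
[a+b]^n≤b^n*y x y n a b eˣ≤y xb≡na = ℕ→ℚᵘ-cancel-≤ (begin
  ℕ→ℚᵘ ((a + b) ^ n)                                ≡⟨ cong ℕ→ℚᵘ (binomial-theorem n a b) ⟩
  ℕ→ℚᵘ (sumUpTo (binomialTerm n a b) n)             ≤⟨ sumUpTo≤B*expPartial x (b ^ n) (binomialTerm n a b)
                                                          (binomialTerm*j!≤b^n*x^j xb≡na) n ⟩
  ℕ→ℚᵘ (b ^ n) ℚᵘ.* ℚ.toℚᵘ (expPartial x n)         ≤⟨ ℚᵘ.*-monoʳ-≤-nonNeg (ℕ→ℚᵘ (b ^ n)) (ℚ.toℚᵘ-mono-≤ (eˣ≤y n)) ⟩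
  ℕ→ℚᵘ (b ^ n) ℚᵘ.* ℚ.toℚᵘ (ℤ.+ y ℚ./ 1)            ≃⟨ ℚᵘ.*-congˡ {ℕ→ℚᵘ (b ^ n)} (toℚᵘ-/ (ℤ.+ y) 1) ⟩
  ℕ→ℚᵘ (b ^ n) ℚᵘ.* ℕ→ℚᵘ y                          ≃⟨ ℕ→ℚᵘ-homo-* (b ^ n) y ⟨
  ℕ→ℚᵘ (b ^ n * y)                                  ∎)
  where open ℚᵘ.≤-Reasoning

ExpLe⇒< : ∀ x y → ExpLe x y → x < y
ExpLe⇒< x y eˣ≤y = subst₂ _≤_ (trans (*-identityʳ (x + 1)) (+-comm x 1)) (+-identityʳ y)
  ([a+b]^n≤b^n*y x y 1 x 1 eˣ≤y (*-comm x 1))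

-- (1 + k/l)^(2kl) ≤ exp(2k²) ≤ kˡ; take l-th roots.
LBound⇒[[k+l]^k]²≤k*[l^k]² : ∀ k l .{{_ : NonZero l}} → LBound k l →
                              (k + l) ^ k * (k + l) ^ k ≤ k * (l ^ k * l ^ k)
LBound⇒[[k+l]^k]²≤k*[l^k]² k l lbound = ^-cancelˡ-≤ l (begin
  ((k + l) ^ k * (k + l) ^ k) ^ l  ≡⟨ cong (_^ l) (^-distribˡ-+-* (k + l) k k) ⟨
  ((k + l) ^ (k + k)) ^ l          ≡⟨ ^-*-assoc (k + l) (k + k) l ⟩
  (k + l) ^ ((k + k) * l)          ≤⟨ [a+b]^n≤b^n*y (2 * (k * k)) (k ^ l) ((k + k) * l) k l lbound (solve (k ∷ l ∷ [])) ⟩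
  l ^ ((k + k) * l) * k ^ l        ≡⟨ cong (_* k ^ l) (^-*-assoc l (k + k) l) ⟨
  (l ^ (k + k)) ^ l * k ^ l        ≡⟨ cong (λ t → t ^ l * k ^ l) (^-distribˡ-+-* l k k) ⟩
  (l ^ k * l ^ k) ^ l * k ^ l      ≡⟨ *-comm ((l ^ k * l ^ k) ^ l) (k ^ l) ⟩
  k ^ l * (l ^ k * l ^ k) ^ l      ≡⟨ ^-distrib-* k (l ^ k * l ^ k) l ⟨
  (k * (l ^ k * l ^ k)) ^ l        ∎)
  where open ≤-Reasoning

-- For r = A/B: r ≥ l/k and r ≥ 1 + k²/l, so r² ≥ l/k + k > k.
k*[B*B]<A*A : ∀ k l A B → 0 < l → 0 < B → l * B ≤ k * A → B * (l + k * k) ≤ l * A →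
              k * (B * B) < A * A
k*[B*B]<A*A k l A B 0<l 0<B lB≤kA B[l+k²]≤lA = *-cancelˡ-< k (k * (B * B)) (A * A) (begin-strict
  k * (k * (B * B))    ≡⟨ solve (k ∷ B ∷ []) ⟩
  B * B * (k * k)      <⟨ *-monoʳ-< (B * B) {{>-nonZero (*-mono-< 0<B 0<B)}} (m<n+m (k * k) 0<l) ⟩
  B * B * (l + k * k)  ≤⟨ *-cancelˡ-≤ l {{>-nonZero 0<l}} (begin
    l * (B * B * (l + k * k))  ≡⟨ solve (l ∷ B ∷ k ∷ []) ⟩
    l * B * (B * (l + k * k))  ≤⟨ *-mono-≤ lB≤kA B[l+k²]≤lA ⟩
    k * A * (l * A)            ≡⟨ solve (k ∷ A ∷ l ∷ []) ⟩
    l * (k * (A * A))          ∎) ⟩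
  k * (A * A)          ∎)
  where open ≤-Reasoning

lemma3 : (k l : ℕ) → 2 ≤ k → LBound k l →
    ⌈ (2 * k + l) / k ⌉ * ((k + l) C k) > (2 * k + l) C k
lemma3 zero        _         ()
lemma3 k@(suc _)   zero      _ lbound = contradiction (ExpLe⇒< (2 * (k * k)) 1 lbound) λ { (s≤s ()) }
lemma3 k@(suc k-1) l@(suc _) _ lbound = ≰⇒> λ cC₁≤C₂ →
  <⇒≱ (k*[B*B]<A*A k l A B z<s (m^n>0 l k) (l*B≤k*A cC₁≤C₂) bernoulli) (LBound⇒[[k+l]^k]²≤k*[l^k]² k l lbound)
  where
  c  = ⌈ (2 * k + l) / k ⌉
  C₁ = (k + l) C k
  C₂ = (2 * k + l) C k
  A  = (k + l) ^ k
  B  = l ^ k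
  ratio : C₂ * B ≤ C₁ * A
  ratio = subst (λ n → (n C k) * B ≤ C₁ * A)
                (trans (sym (+-assoc k k l)) (cong (λ m → k + m + l) (sym (+-identityʳ k))))
                ([k+a]Ck*b^k≤[k+b]Ck*a^k (m≤n+m l k) k)
  bernoulli : B * (l + k * k) ≤ l * A
  bernoulli = subst (λ s → B * (l + k * k) ≤ l * s ^ k) (+-comm l k) (l^m*[l+m*d]≤l*[l+d]^m l k k)
  l*B≤k*A : c * C₁ ≤ C₂ → l * B ≤ k * A
  l*B≤k*A cC₁≤C₂ = begin
    l * B        ≤⟨ *-monoˡ-≤ B (≤-trans (m≤n+m l (2 * k)) (m≤n*⌈m/n⌉ (2 * k + l) k-1)) ⟩
    k * c * B    ≡⟨ *-assoc k c B ⟩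
    k * (c * B)  ≤⟨ *-monoʳ-≤ k (m*o≤n⇒n*p≤o*q⇒m*p≤q {c} (nCk>0 (m≤m+n k l)) cC₁≤C₂ ratio) ⟩
    k * A        ∎
    where open ≤-Reasoning
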